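{- Let $s\ge 2$, $n\ge 1$, and let $A=\{A^1,\dots,A^n\}$ be an assignment. Let $\mathcal{D}$ be a family of subsets of $\{1,\dots,s\}$ such that $\varnothing\notin\mathcal{D}$, $\{1,\dots,s\}\notin\mathcal{D}$, and for every $D\in\mathcal{D}$ its complement $\overline{D}=\{1,\dots,s\}\setminus D$ is not in $\mathcal{D}$. Let $N_{\mathcal{D}}(A)=\{p_D(A,\rho): D\in\mathcal{D},\ \rho \text{ a permutation of } \{1,\dots,n\}\}$. Then for $D_1,D_2\in\mathcal{D}$ and permutations $\rho_1,\rho_2$, if $D_1\neq D_2$ then $p_{D_1}(A,\rho_1)=p_{D_2}(A,\rho_2)$ holds if and only if $\rho_1=\rho_2$ is the identity; and if $\mathcal D\neq\varnothing$ then $|N_{\mathcal{D}}(A)|=|\mathcal{D}|\cdot(n!-1)+1$.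
   Context: Let $X=\{1,\dots,n\}^s$; $e_j$ denotes the $j$-th coordinate of $e\in X$. An assignment is a set of $n$ vectors $A^1,\dots,A^n\in X$ with $A^i_j\ne A^k_j$ for all $i\ne k$ and all $j$. Assignments are compared as sets of vectors. For $u,v\in X$ and $D\subseteq\{1,\dots,s\}$, $\mathrm{swap}(u,v,D)$ is the vector with $j$-th coordinate $v_j$ if $j\in D$ and $u_j$ otherwise. For an assignment $A=\{A^1,\dots,A^n\}$, $D\subseteq\{1,\dots,s\}$ and a permutation $\rho$ of $\{1,\dots,n\}$, $p_D(A,\rho)=\{\mathrm{swap}(A^i,A^{\rho(i)},D): i=1,\dots,n\}$. -}

module Defs where

open import Data.Nat using (ℕ)
open import Data.Bool using (if_then_else_)
open import Data.Fin using (Fin)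
open import Data.Fin.Subset using (Subset)
open import Data.Fin.Permutation using (Permutation′; _⟨$⟩ʳ_)
open import Data.Vec using (lookup)
open import Data.List using (List; length)
open import Data.List.Relation.Unary.All using (All)
open import Data.List.Relation.Unary.Any using (Any)
open import Data.List.Relation.Unary.AllPairs using (AllPairs)
open import Data.List.Membership.Propositional using (_∈_)
open import Data.Product using (Σ; ∃; _×_)
open import Relation.Binary.PropositionalEquality using (_≡_; _≢_)
open import Relation.Nullary using (¬_)

X : ℕ → ℕ → Set
X n s = Fin s → Fin n

_≈X_ : ∀ {n s} → X n s → X n s → Set
u ≈X v = ∀ j → u j ≡ v j

Family : ℕ → ℕ → Set
Family n s = Fin n → X n s

IsAssignment : ∀ {n s} → Family n s → Set
IsAssignment {n} {s} A = ∀ (j : Fin s) (i k : Fin n) → i ≢ k → A i j ≢ A k j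

SameSet : ∀ {n s} → Family n s → Family n s → Set
SameSet {n} B C =
  (∀ (i : Fin n) → ∃ λ (k : Fin n) → B i ≈X C k) ×
  (∀ (k : Fin n) → ∃ λ (i : Fin n) → C k ≈X B i)

swap : ∀ {n s} → X n s → X n s → Subset s → X n s
swap u v D j = if lookup D j then v j else u j

p : ∀ {n s} → Subset s → Family n s → Permutation′ n → Family n s
p D A ρ i = swap (A i) (A (ρ ⟨$⟩ʳ i)) D

IsIdentity : ∀ {n} → Permutation′ n → Set
IsIdentity {n} ρ = ∀ (i : Fin n) → ρ ⟨$⟩ʳ i ≡ i

InN : ∀ {n s} → List (Subset s) → Family n s → Family n s → Set
InN {n} {s} 𝒟 A B =
  Σ (Subset s) λ D → Σ (Permutation′ n) λ ρ → D ∈ 𝒟 × SameSet B (p D A ρ)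

-- the collection of sets {B | P B} (sets of vectors up to SameSet) has exactly k elements:
-- there is a list of k pairwise distinct representatives that are in P and
-- represent every element of P
HasCard : ∀ {n s} → (Family n s → Set) → ℕ → Set
HasCard {n} {s} P k =
  Σ (List (Family n s)) λ L →
    All P L ×
    (∀ B → P B → Any (SameSet B) L) ×
    AllPairs (λ B C → ¬ SameSet B C) L ×
    length L ≡ k

-- In an assignment each coordinate value A^i_j determines the row i, so row i of p_D(A,ρ)
-- is determined by its source pattern j ↦ (ρ(i) if j ∈ D, else i). When ρ(i) ≠ i this
-- pattern recovers D up to complement; hence, for D₁ ≠ D₂ neither complementary, a row of
-- p_{D₁}(A,ρ₁) can only occur in p_{D₂}(A,ρ₂) if it is fixed by ρ₁. For a single proper D,
-- one coordinate inside and one outside D read off ρ from the set p_D(A,ρ). So N_𝒟(A)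
-- consists of A and the |𝒟|·(n! − 1) pairwise distinct sets p_D(A,ρ) with ρ ≠ id.
module Submission where

open import Defs
open import Data.Nat using (ℕ; _≤_; _*_; _∸_; _+_; _!)
open import Data.Fin.Subset using (Subset; ⊥; ⊤; ∁)
open import Data.Fin.Permutation using (Permutation′)
open import Data.List using (List; []; length)
open import Data.List.Relation.Unary.Unique.Propositional using (Unique)
open import Data.List.Membership.Propositional using (_∈_; _∉_)
open import Data.Product using (_×_)
open import Function.Bundles using (_⇔_)
open import Relation.Binary.PropositionalEquality using (_≡_; _≢_)

open import Level using (0ℓ)
open import Data.Bool using (Bool; true; false; not; if_then_else_)
open import Data.Bool.Properties using (¬-not; if-float; if-eta; if-not)
import Data.Bool.Properties as Bool
open import Data.Nat using (zero; suc)
open import Data.Nat.Properties using (+-comm)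
open import Data.Fin using (Fin; zero; suc; punchIn; _≟_)
open import Data.Fin.Properties using (punchIn-injective)
open import Data.Fin.Permutation using (_⟨$⟩ʳ_; _≈_; insert; remove; insert-remove)
  renaming (id to idₚ)
open import Data.Vec using (Vec; lookup; replicate; tabulate; _∷_; [])
open import Data.Vec.Properties using (lookup-map; tabulate∘lookup; tabulate-cong)
open import Data.List using (_∷_; map; _++_; allFin; cartesianProductWith)
open import Data.List.Properties using (length-++; length-map; length-tabulate)
open import Data.List.Relation.Unary.All as All using (All; []; _∷_)
import Data.List.Relation.Unary.All.Properties as All
open import Data.List.Relation.Unary.AllPairs as AllPairs using ([]; _∷_)
import Data.List.Relation.Unary.AllPairs.Properties as AllPairsₚ
open import Data.List.Relation.Unary.Any using (Any; here; there)
import Data.List.Relation.Unary.Any.Properties as Any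
open import Data.List.Relation.Unary.Unique.Setoid using () renaming (Unique to Uniqueₛ)
import Data.List.Relation.Unary.Unique.Setoid.Properties as Unique
open import Data.List.Relation.Unary.Unique.Propositional.Properties using (allFin⁺)
open import Data.List.Membership.Propositional.Properties using (∈-allFin)
open import Data.Product using (∃; ∃₂; _,_; proj₁; proj₂)
import Data.Product as Product
open import Data.Sum using (_⊎_; inj₁; inj₂; [_,_]′)
open import Function using (_∘_; id)
open import Data.Empty using (⊥-elim)
open import Function.Bundles using (mk⇔)
open import Relation.Binary.Bundles using (Setoid)
open import Relation.Binary.PropositionalEquality
  using (refl; sym; trans; cong; cong₂; subst; setoid; module ≡-Reasoning)
open import Relation.Nullary using (¬_; yes; no; contradiction)

permutationSetoid : ℕ → Setoid 0ℓ 0ℓ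
permutationSetoid n = record
  { Carrier       = Permutation′ n
  ; _≈_           = _≈_
  ; isEquivalence = record
    { refl  = λ _ → refl
    ; sym   = λ π≈ρ i → sym (π≈ρ i)
    ; trans = λ π≈ρ ρ≈σ i → trans (π≈ρ i) (ρ≈σ i)
    }
  }

length-cartesianProductWith : ∀ {a b c} {A : Set a} {B : Set b} {C : Set c}
  (f : A → B → C) (xs : List A) (ys : List B) →
  length (cartesianProductWith f xs ys) ≡ length xs * length ys
length-cartesianProductWith f []       ys = refl
length-cartesianProductWith f (x ∷ xs) ys = begin
  length (map (f x) ys ++ cartesianProductWith f xs ys)  ≡⟨ length-++ (map (f x) ys) ⟩
  length (map (f x) ys) + length (cartesianProductWith f xs ys)
    ≡⟨ cong₂ _+_ (length-map (f x) ys) (length-cartesianProductWith f xs ys) ⟩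
  length ys + length xs * length ys  ∎
  where open ≡-Reasoning

permutations : ∀ n → List (Permutation′ n)
permutations zero    = idₚ ∷ []
permutations (suc n) = cartesianProductWith (insert zero) (allFin (suc n)) (permutations n)

length-permutations : ∀ n → length (permutations n) ≡ n !
length-permutations zero    = refl
length-permutations (suc n) = begin
  length (permutations (suc n))
    ≡⟨ length-cartesianProductWith (insert zero) (allFin (suc n)) (permutations n) ⟩
  length (allFin (suc n)) * length (permutations n)
    ≡⟨ cong₂ _*_ (length-tabulate {n = suc n} id) (length-permutations n) ⟩
  suc n * n !
    ∎
  where open ≡-Reasoning

insert-remove₀ : ∀ {n} (σ : Permutation′ (suc n)) {π : Permutation′ n} →
  remove zero σ ≈ π → σ ≈ insert zero (σ ⟨$⟩ʳ zero) π
insert-remove₀ σ σ⁻≈π zero    = refl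
insert-remove₀ σ σ⁻≈π (suc i) =
  trans (sym (insert-remove zero σ (suc i))) (cong (punchIn (σ ⟨$⟩ʳ zero)) (σ⁻≈π i))

permutations-complete : ∀ n (σ : Permutation′ n) → Any (σ ≈_) (permutations n)
permutations-complete zero    σ = here (λ ())
permutations-complete (suc n) σ =
  Any.cartesianProductWith⁺ (insert zero) (λ { refl σ⁻≈π → insert-remove₀ σ σ⁻≈π })
    (∈-allFin (σ ⟨$⟩ʳ zero)) (permutations-complete n (remove zero σ))

insert₀-injective : ∀ {n} {i j : Fin (suc n)} {π ρ : Permutation′ n} →
  insert zero i π ≈ insert zero j ρ → i ≡ j × π ≈ ρ
insert₀-injective {i = i} eq with eq zero
... | refl = refl , λ k → punchIn-injective i _ _ (eq (suc k))

permutations-unique : ∀ n → Uniqueₛ (permutationSetoid n) (permutations n)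
permutations-unique zero    = [] ∷ []
permutations-unique (suc n) =
  Unique.cartesianProductWith⁺ (setoid (Fin (suc n))) (permutationSetoid n) (permutationSetoid (suc n))
    (insert zero) insert₀-injective (allFin⁺ (suc n)) (permutations-unique n)

permutations-head : ∀ n → ∃₂ λ ι rest → permutations n ≡ ι ∷ rest × IsIdentity ι
permutations-head zero = idₚ , [] , refl , λ _ → refl
permutations-head (suc n) with permutations-head n
... | ι , rest , eq , ι-id =
  insert zero zero ι , _ , cong (cartesianProductWith (insert zero) (allFin (suc n))) eq , lift-id
  where
  lift-id : IsIdentity (insert zero zero ι)
  lift-id zero    = refl
  lift-id (suc i) = cong suc (ι-id i)

lookup-injective : ∀ {a} {A : Set a} {m} (u v : Vec A m) → (∀ j → lookup u j ≡ lookup v j) → u ≡ v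
lookup-injective u v u≗v = begin
  u                   ≡⟨ tabulate∘lookup u ⟨
  tabulate (lookup u) ≡⟨ tabulate-cong u≗v ⟩
  tabulate (lookup v) ≡⟨ tabulate∘lookup v ⟩
  v                   ∎
  where open ≡-Reasoning

≢replicate⇒∃lookup≡not : ∀ {m} b (v : Vec Bool m) → v ≢ replicate m b → ∃ λ j → lookup v j ≡ not b
≢replicate⇒∃lookup≡not b []      v≢ = contradiction refl v≢
≢replicate⇒∃lookup≡not b (x ∷ v) v≢ with x Bool.≟ b
... | yes refl = Product.map suc id (≢replicate⇒∃lookup≡not b v (v≢ ∘ cong (b ∷_)))
... | no  x≢b  = zero , ¬-not x≢b

record Proper {s} (D : Subset s) : Set where
  constructor mkProper
  field
    member    : ∃ λ j → lookup D j ≡ true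
    nonmember : ∃ λ j → lookup D j ≡ false

proper : ∀ {s} {D : Subset s} → D ≢ ⊥ → D ≢ ⊤ → Proper D
proper {D = D} D≢⊥ D≢⊤ =
  mkProper (≢replicate⇒∃lookup≡not false D D≢⊥) (≢replicate⇒∃lookup≡not true D D≢⊤)

module _ {a} {T : Set a} {x y : T} (x≢y : x ≢ y) where

  if-injective : ∀ b c → (if b then x else y) ≡ (if c then x else y) → b ≡ c
  if-injective true  true  _   = refl
  if-injective true  false x≡y = contradiction x≡y x≢y
  if-injective false true  y≡x = contradiction (sym y≡x) x≢y
  if-injective false false _   = refl

  if-values : ∀ {u v : T} b c → x ≡ (if b then u else v) → y ≡ (if c then u else v) →
    (u ≡ x × v ≡ y) ⊎ (u ≡ y × v ≡ x)
  if-values true  true  refl refl = contradiction refl x≢y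
  if-values true  false refl refl = inj₁ (refl , refl)
  if-values false true  refl refl = inj₂ (refl , refl)
  if-values false false refl refl = contradiction refl x≢y

  if-lookup⇒≡⊎≡∁ : ∀ {m} {u v : T} (D E : Subset m) → Proper D →
    (∀ j → (if lookup D j then x else y) ≡ (if lookup E j then u else v)) → D ≡ E ⊎ D ≡ ∁ E
  if-lookup⇒≡⊎≡∁ D E (mkProper (j₁ , D∋j₁) (j₀ , D∌j₀)) eq
    with if-values (lookup E j₁) (lookup E j₀)
           (subst (λ b → (if b then x else y) ≡ _) D∋j₁ (eq j₁))
           (subst (λ b → (if b then x else y) ≡ _) D∌j₀ (eq j₀))
  ... | inj₁ (refl , refl) = inj₁ (lookup-injective D E λ j → if-injective _ _ (eq j))
  ... | inj₂ (refl , refl) = inj₂ (lookup-injective D (∁ E) λ j →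
          trans (if-injective _ _ (trans (eq j) (sym (if-not (lookup E j))))) (sym (lookup-map j not E)))

_⊑_ : ∀ {n s} → Family n s → Family n s → Set
B ⊑ C = ∀ i → ∃ λ k → B i ≈X C k

⊑-trans : ∀ {n s} {B C E : Family n s} → B ⊑ C → C ⊑ E → B ⊑ E
⊑-trans B⊑C C⊑E i with B⊑C i
... | k , Bi≈Ck with C⊑E k
... | l , Ck≈El = l , λ j → trans (Bi≈Ck j) (Ck≈El j)

familySetoid : ℕ → ℕ → Setoid 0ℓ 0ℓ
familySetoid n s = record
  { Carrier       = Family n s
  ; _≈_           = SameSet
  ; isEquivalence = record
    { refl  = ⊑-refl , ⊑-refl
    ; sym   = λ (B⊑C , C⊑B) → C⊑B , B⊑C
    ; trans = λ (B⊑C , C⊑B) (C⊑E , E⊑C) → ⊑-trans B⊑C C⊑E , ⊑-trans E⊑C C⊑B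
    }
  }
  where
  ⊑-refl : ∀ {B : Family n s} → B ⊑ B
  ⊑-refl i = i , λ _ → refl

pointwise⇒SameSet : ∀ {n s} {B C : Family n s} → (∀ i → B i ≈X C i) → SameSet B C
pointwise⇒SameSet B≈C = (λ i → i , B≈C i) , (λ k → k , λ j → sym (B≈C k j))

module Assignment {n s} (A : Family n s) (isAssignment : IsAssignment A) where

  open Setoid (familySetoid n s) using () renaming (refl to SameSet-refl; trans to SameSet-trans)

  row-injective : ∀ {i k j} → A i j ≡ A k j → i ≡ k
  row-injective {i} {k} {j} Aij≡Akj with i ≟ k
  ... | yes i≡k = i≡k
  ... | no  i≢k = contradiction Aij≡Akj (isAssignment j i k i≢k)

  swap-source : ∀ D E {i a k b j} → swap (A i) (A a) D j ≡ swap (A k) (A b) E j →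
    (if lookup D j then a else i) ≡ (if lookup E j then b else k)
  swap-source D E {i} {a} {k} {b} {j} eq = row-injective (begin
    A (if lookup D j then a else i) j  ≡⟨ if-float (λ r → A r j) (lookup D j) ⟩
    swap (A i) (A a) D j               ≡⟨ eq ⟩
    swap (A k) (A b) E j               ≡⟨ if-float (λ r → A r j) (lookup E j) ⟨
    A (if lookup E j then b else k) j  ∎)
    where open ≡-Reasoning

  p-identity : ∀ D ρ → IsIdentity ρ → ∀ i → p D A ρ i ≈X A i
  p-identity D ρ ρ-id i j = trans (cong (λ r → swap (A i) (A r) D j) (ρ-id i)) (if-eta (lookup D j))

  p-cong : ∀ D ρ σ → ρ ≈ σ → ∀ i → p D A ρ i ≈X p D A σ i
  p-cong D ρ σ ρ≈σ i j = cong (λ r → swap (A i) (A r) D j) (ρ≈σ i)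

  ⊑⇒identity : ∀ {D E} ρ σ → Proper D → D ≢ E → D ≢ ∁ E → p D A ρ ⊑ p E A σ → IsIdentity ρ
  ⊑⇒identity {D} {E} ρ σ D-proper D≢E D≢∁E ⊑ i with ρ ⟨$⟩ʳ i ≟ i
  ... | yes ρi≡i = ρi≡i
  ... | no  ρi≢i with ⊑ i
  ...   | k , rows≈ =
    ⊥-elim ([ D≢E , D≢∁E ]′ (if-lookup⇒≡⊎≡∁ ρi≢i D E D-proper λ j → swap-source D E (rows≈ j)))

  ⊑⇒≈ : ∀ {D} ρ σ → Proper D → p D A ρ ⊑ p D A σ → ρ ≈ σ
  ⊑⇒≈ {D} ρ σ (mkProper (j₁ , D∋j₁) (j₀ , D∌j₀)) ⊑ i with ⊑ i
  ... | k , rows≈ = trans (at j₁ D∋j₁) (cong (σ ⟨$⟩ʳ_) (sym (at j₀ D∌j₀)))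
    where
    at : ∀ j {b} → lookup D j ≡ b → (if b then ρ ⟨$⟩ʳ i else i) ≡ (if b then σ ⟨$⟩ʳ k else k)
    at j refl = swap-source D D (rows≈ j)

  p⊑A⇒identity : ∀ {D} ρ → Proper D → p D A ρ ⊑ A → IsIdentity ρ
  p⊑A⇒identity {D} ρ D-proper ⊑A =
    ⊑⇒≈ ρ idₚ D-proper (⊑-trans ⊑A λ i → i , λ j → sym (p-identity D idₚ (λ _ → refl) i j))

  SameSet-p⇔identity : ∀ {D E} ρ σ → Proper D → Proper E → D ≢ E → D ≢ ∁ E → E ≢ ∁ D →
    SameSet (p D A ρ) (p E A σ) ⇔ (IsIdentity ρ × IsIdentity σ)
  SameSet-p⇔identity {D} {E} ρ σ D-proper E-proper D≢E D≢∁E E≢∁D = mk⇔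
    (λ (⊑ , ⊒) → ⊑⇒identity ρ σ D-proper D≢E D≢∁E ⊑ ,
                 ⊑⇒identity σ ρ E-proper (D≢E ∘ sym) E≢∁D ⊒)
    (λ (ρ-id , σ-id) → pointwise⇒SameSet λ i j →
      trans (p-identity D ρ ρ-id i j) (sym (p-identity E σ σ-id i j)))

  images : List (Subset s) → List (Permutation′ n) → List (Family n s)
  images = cartesianProductWith (λ D → p D A)

  images-unique : ∀ {ts} → All (¬_ ∘ IsIdentity) ts → Uniqueₛ (permutationSetoid n) ts →
    ∀ {𝒟} → (∀ {D} → D ∈ 𝒟 → Proper D) → (∀ {D E} → D ∈ 𝒟 → E ∈ 𝒟 → D ≢ ∁ E) →
    Unique 𝒟 → Uniqueₛ (familySetoid n s) (images 𝒟 ts)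
  images-unique ts≠id ts! {[]}    _      _  []          = []
  images-unique {ts} ts≠id ts! {D ∷ 𝒟} 𝒟-proper no-∁ (D∉𝒟 ∷ 𝒟!) = AllPairsₚ.++⁺
    (Unique.map⁺ (permutationSetoid n) (familySetoid n s) (λ {ρ} {σ} → ⊑⇒≈ ρ σ D-proper ∘ proj₁) ts!)
    (images-unique ts≠id ts! (𝒟-proper ∘ there) (λ D∈ E∈ → no-∁ (there D∈) (there E∈)) 𝒟!)
    (All.map⁺ (All.tabulate λ {ρ} ρ∈ts →
      All.cartesianProductWith⁺ (setoid _) (setoid _) _ 𝒟 ts λ {_} {σ} E∈𝒟 _ (⊑ , _) →
        All.lookup ts≠id ρ∈ts
          (⊑⇒identity ρ σ D-proper (All.lookup D∉𝒟 E∈𝒟) (no-∁ (here refl) (there E∈𝒟)) ⊑)))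
    where
    D-proper : Proper D
    D-proper = 𝒟-proper (here refl)

  InN-hasCard : ∀ {𝒟} → Unique 𝒟 → 𝒟 ≢ [] →
    (∀ {D} → D ∈ 𝒟 → Proper D) → (∀ {D E} → D ∈ 𝒟 → E ∈ 𝒟 → D ≢ ∁ E) →
    HasCard (InN 𝒟 A) (length 𝒟 * (n ! ∸ 1) + 1)
  InN-hasCard {𝒟} 𝒟! 𝒟≢[] 𝒟-proper no-∁ with permutations-head n
  ... | ι , ts , perms≡ , ι-id =
    A ∷ images 𝒟 ts , A∈N 𝒟≢[] ∷ images∈N , N⊆L ,
    A∉images ∷ images-unique ts≠id ts! 𝒟-proper no-∁ 𝒟! , length-L
    where
    ιts! : Uniqueₛ (permutationSetoid n) (ι ∷ ts)
    ιts! = subst (Uniqueₛ (permutationSetoid n)) perms≡ (permutations-unique n)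

    ts! : Uniqueₛ (permutationSetoid n) ts
    ts! = AllPairs.tail ιts!

    ts≠id : All (¬_ ∘ IsIdentity) ts
    ts≠id = All.map (λ ι≉ρ ρ-id → ι≉ρ λ i → trans (ι-id i) (sym (ρ-id i))) (AllPairs.head ιts!)

    A∈N : ∀ {𝒟} → 𝒟 ≢ [] → InN 𝒟 A A
    A∈N {[]}    𝒟≢[] = contradiction refl 𝒟≢[]
    A∈N {D ∷ _} _    =
      D , idₚ , here refl , pointwise⇒SameSet λ i j → sym (p-identity D idₚ (λ _ → refl) i j)

    images∈N : All (InN 𝒟 A) (images 𝒟 ts)
    images∈N = All.cartesianProductWith⁺ (setoid _) (setoid _) _ 𝒟 ts
      λ {D} {ρ} D∈𝒟 _ → D , ρ , D∈𝒟 , SameSet-refl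

    N⊆L : ∀ B → InN 𝒟 A B → Any (SameSet B) (A ∷ images 𝒟 ts)
    N⊆L B (D , ρ , D∈𝒟 , B≈pDρ) with subst (Any (ρ ≈_)) perms≡ (permutations-complete n ρ)
    ... | here  ρ≈ι  =
      here (SameSet-trans B≈pDρ (pointwise⇒SameSet (p-identity D ρ λ i → trans (ρ≈ι i) (ι-id i))))
    ... | there ρ∈ts =
      there (Any.cartesianProductWith⁺ _
        (λ { {y = σ} refl ρ≈σ → SameSet-trans B≈pDρ (pointwise⇒SameSet (p-cong D ρ σ ρ≈σ)) })
        D∈𝒟 ρ∈ts)

    A∉images : All (λ B → ¬ SameSet A B) (images 𝒟 ts)
    A∉images = All.cartesianProductWith⁺ (setoid _) (setoid _) _ 𝒟 ts λ {D} {ρ} D∈𝒟 ρ∈ts A≈pDρ →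
      All.lookup ts≠id ρ∈ts (p⊑A⇒identity ρ (𝒟-proper D∈𝒟) (proj₂ A≈pDρ))

    length-L : suc (length (images 𝒟 ts)) ≡ length 𝒟 * (n ! ∸ 1) + 1
    length-L = begin
      suc (length (images 𝒟 ts))  ≡⟨ cong suc (length-cartesianProductWith _ 𝒟 ts) ⟩
      suc (length 𝒟 * length ts)   ≡⟨ cong (λ m → suc (length 𝒟 * m)) |ts| ⟩
      suc (length 𝒟 * (n ! ∸ 1))   ≡⟨ +-comm 1 _ ⟩
      length 𝒟 * (n ! ∸ 1) + 1     ∎
      where
      open ≡-Reasoning
      |ts| : length ts ≡ n ! ∸ 1
      |ts| = cong (_∸ 1) (trans (cong length (sym perms≡)) (length-permutations n))

mainTheorem2 : (s n : ℕ) → 2 ≤ s → 1 ≤ n →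
    (A : Family n s) → IsAssignment A →
    (𝒟 : List (Subset s)) → Unique 𝒟 →
    ⊥ ∉ 𝒟 → ⊤ ∉ 𝒟 → (∀ D → D ∈ 𝒟 → ∁ D ∉ 𝒟) →
    ((D₁ D₂ : Subset s) → D₁ ∈ 𝒟 → D₂ ∈ 𝒟 → (ρ₁ ρ₂ : Permutation′ n) → D₁ ≢ D₂ →
       (SameSet (p D₁ A ρ₁) (p D₂ A ρ₂) ⇔ (IsIdentity ρ₁ × IsIdentity ρ₂)))
    × (𝒟 ≢ [] → HasCard (InN 𝒟 A) (length 𝒟 * ((n !) ∸ 1) + 1))
mainTheorem2 s n _ _ A isAssignment 𝒟 𝒟! ⊥∉𝒟 ⊤∉𝒟 ∁∉𝒟 =
  (λ D₁ D₂ D₁∈𝒟 D₂∈𝒟 ρ₁ ρ₂ D₁≢D₂ →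
    SameSet-p⇔identity ρ₁ ρ₂ (𝒟-proper D₁∈𝒟) (𝒟-proper D₂∈𝒟)
      D₁≢D₂ (no-∁ D₁∈𝒟 D₂∈𝒟) (no-∁ D₂∈𝒟 D₁∈𝒟)) ,
  (λ 𝒟≢[] → InN-hasCard 𝒟! 𝒟≢[] 𝒟-proper no-∁)
  where
  open Assignment A isAssignment

  𝒟-proper : ∀ {D} → D ∈ 𝒟 → Proper D
  𝒟-proper D∈𝒟 = proper (λ { refl → ⊥∉𝒟 D∈𝒟 }) (λ { refl → ⊤∉𝒟 D∈𝒟 })

  no-∁ : ∀ {D E} → D ∈ 𝒟 → E ∈ 𝒟 → D ≢ ∁ E
  no-∁ D∈𝒟 E∈𝒟 refl = ∁∉𝒟 _ E∈𝒟 D∈𝒟
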